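{- A binary function is matroidal (i.e. $1$-polymatroidal) if and only if it has no minor isomorphic to any of: (i) $f_\alpha$, where $\alpha\in\mathbb{R}\setminus\{0,1\}$; (ii) $g\colon 2^{\{a,b\}}\to\mathbb{R}$ with $g(X)=1$ if $|X|\in\{0,1\}$ and $g(X)=-1$ if $|X|=2$.
   Context: A binary function on a finite ground set $E$ is a function $f\colon 2^E\to\mathbb{R}$ with $f(\emptyset)=1$. Its rank function $Qf\colon 2^E\to\mathbb{R}$ is $Qf(X)=\log_2\left(\frac{\sum_{Y\subseteq E} f(Y)}{\sum_{Y\subseteq E\setminus X} f(Y)}\right)$; $f$ is rankable if $Qf(X)$ is well defined for every $X\subseteq E$. The binary function $f$ is matroidal ($1$-polymatroidal) if it is rankable and $Qf$ satisfies: $Qf(X)$ is a nonnegative integer for all $X\subseteq E$; $Qf(X)\leq |X|$ for all $X\subseteq E$; $Qf(X)\leq Qf(X\cup\{e\})$ for all $X\subseteq E$, $e\in E\setminus X$; and $Qf(X)+Qf(X\cup\{a,b\})\leq Qf(X\cup\{a\})+Qf(X\cup\{b\})$ for all $X\subseteq E$ and distinct $a,b\in E\setminus X$ (i.e. $Qf$ is a matroid rank function). For $X\subseteq E$, the contraction $f/X\colon 2^{E\setminus X}\to\mathbb{R}$ is $f/X(Y)=f(Y)$, and the deletion $f\setminus X\colon 2^{E\setminus X}\to\mathbb{R}$ is $f\setminus X(Y)=\frac{\sum_{Z\subseteq X} f(Y\cup Z)}{\sum_{Z\subseteq X} f(Z)}$, well defined exactly when the denominator is nonzero. A minor of $f$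 is a well-defined binary function $(f/X)\setminus Y$ for disjoint $X,Y\subseteq E$. Two binary functions $f$ on $E$ and $f'$ on $E'$ are isomorphic if there is a bijection $\phi\colon E\to E'$ with $f(X)=f'(\phi(X))$ for all $X\subseteq E$. For $\alpha\in\mathbb{R}$, $f_\alpha$ denotes the binary function on a one-element ground set $E$ with $f_\alpha(E)=\alpha$. -}

module Defs where

open import Level using (0ℓ)
open import Data.Nat as ℕ using (ℕ; zero; suc)
open import Data.Fin using (Fin)
open import Data.Fin.Subset using (Subset; Side; inside; outside; ⊥; ∁; _∪_; _∈_; _∉_; ∣_∣)
open import Data.Vec using (Vec; []; _∷_)
open import Data.Product using (Σ; ∃; _×_; _,_)
open import Data.Sum using (_⊎_)
open import Relation.Nullary using (¬_)
open import Relation.Binary.PropositionalEquality using (_≡_; _≢_)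
open import Function.Definitions using (Injective)
open import Function.Bundles using (_⇔_)

-- The real numbers, axiomatised as a complete ordered field
-- (unique up to isomorphism, so quantifying over all such structures
-- is the same as speaking about ℝ).  Equality is propositional.

record RealField : Set₁ where
  infixl 6 _+_
  infixl 7 _*_
  infix 4 _≤_
  field
    Carrier : Set
    0# 1#   : Carrier
    _+_ _*_ : Carrier → Carrier → Carrier
    -_      : Carrier → Carrier
    _⁻¹     : Carrier → Carrier      -- total; 0 ⁻¹ is unspecified
    _≤_     : Carrier → Carrier → Set
    +-assoc     : ∀ x y z → (x + y) + z ≡ x + (y + z)
    +-comm      : ∀ x y → x + y ≡ y + x
    +-identityˡ : ∀ x → 0# + x ≡ x
    -‿inverseˡ  : ∀ x → (- x) + x ≡ 0#
    *-assoc     : ∀ x y z → (x * y) * z ≡ x * (y * z)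
    *-comm      : ∀ x y → x * y ≡ y * x
    *-identityˡ : ∀ x → 1# * x ≡ x
    distribˡ    : ∀ x y z → x * (y + z) ≡ (x * y) + (x * z)
    0≢1         : 0# ≢ 1#
    ⁻¹-inverseˡ : ∀ x → x ≢ 0# → (x ⁻¹) * x ≡ 1#
    ≤-refl    : ∀ x → x ≤ x
    ≤-antisym : ∀ x y → x ≤ y → y ≤ x → x ≡ y
    ≤-trans   : ∀ x y z → x ≤ y → y ≤ z → x ≤ z
    ≤-total   : ∀ x y → x ≤ y ⊎ y ≤ x
    +-mono-≤  : ∀ x y z → x ≤ y → x + z ≤ y + z
    *-nonneg  : ∀ x y → 0# ≤ x → 0# ≤ y → 0# ≤ x * y
    sup : (P : Carrier → Set) → ∃ P → (∃ λ b → ∀ x → P x → x ≤ b) →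
          ∃ λ s → (∀ x → P x → x ≤ s) × (∀ b → (∀ x → P x → x ≤ b) → s ≤ b)

module _ (ℝ : RealField) where
  open RealField ℝ

  2^_ : ℕ → Carrier
  2^ zero  = 1#
  2^ suc k = (1# + 1#) * (2^ k)

  sumSub : ∀ {n} → Subset n → (Subset n → Carrier) → Carrier
  sumSub []            F = F []
  sumSub (outside ∷ A) F = sumSub A (λ Z → F (outside ∷ Z))
  sumSub (inside ∷ A)  F = sumSub A (λ Z → F (outside ∷ Z)) + sumSub A (λ Z → F (inside ∷ Z))

  record BinaryFunction (n : ℕ) : Set where
    constructor binfn
    field
      fun   : Subset n → Carrier
      fun-∅ : fun ⊥ ≡ 1#
  open BinaryFunction public

  -- Numerator and denominator of the ratio inside Qf(X):
  --   Qf(X) = log₂ (Σ_{Y ⊆ E} f(Y) / Σ_{Y ⊆ E∖X} f(Y)).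
  total : ∀ {n} → (Subset n → Carrier) → Carrier
  total {n} f = sumSub (∁ ⊥) f

  denom : ∀ {n} → (Subset n → Carrier) → Subset n → Carrier
  denom f X = sumSub (∁ X) f

  -- "Qf(X) is well defined and equals the natural number k":
  -- the ratio is well defined and log₂ of it is k, i.e. it equals 2^k.
  QfIs : ∀ {n} → (Subset n → Carrier) → Subset n → ℕ → Set
  QfIs f X k = denom f X ≢ 0# × (total f * (denom f X ⁻¹) ≡ 2^ k)

  IsMatroidRank : ∀ {n} → (Subset n → ℕ) → Set
  IsMatroidRank {n} r =
      (∀ X → r X ℕ.≤ ∣ X ∣)
    × (∀ X (e : Fin n) → e ∉ X → r X ℕ.≤ r (X ∪ (Data.Fin.Subset.⁅_⁆ e)))
    × (∀ X (a b : Fin n) → a ≢ b → a ∉ X → b ∉ X →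
         r X ℕ.+ r (X ∪ (Data.Fin.Subset.⁅_⁆ a ∪ Data.Fin.Subset.⁅_⁆ b))
           ℕ.≤ r (X ∪ Data.Fin.Subset.⁅_⁆ a) ℕ.+ r (X ∪ Data.Fin.Subset.⁅_⁆ b))

  Matroidal : ∀ {n} → BinaryFunction n → Set
  Matroidal f = ∃ λ (r : Subset _ → ℕ) → (∀ X → QfIs (fun f) X (r X)) × IsMatroidRank r

  -- f has a minor isomorphic to g (g on ground set Fin m):
  -- there are disjoint X (contracted), Y (deleted) ⊆ E, the minor
  -- (f/X)∖Y is well defined, and a bijection φ from E∖(X∪Y) to Fin m,
  -- given by its inverse ι : Fin m → Fin n (injective with image E∖(X∪Y)),
  -- such that (f/X)∖Y (W) = g(φ(W)) for all W ⊆ E∖(X∪Y).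
  -- Here (f/X)∖Y (W) = Σ_{Z⊆Y} f(W∪Z) / Σ_{Z⊆Y} f(Z).
  HasMinorIso : ∀ {n m} → BinaryFunction n → BinaryFunction m → Set
  HasMinorIso {n} {m} f g =
    ∃ λ (X : Subset n) → ∃ λ (Y : Subset n) → ∃ λ (ι : Fin m → Fin n) →
        (∀ e → e ∈ X → e ∉ Y)
      × Injective _≡_ _≡_ ι
      × (∀ e → (e ∉ X × e ∉ Y) ⇔ (∃ λ i → ι i ≡ e))
      × sumSub Y (fun f) ≢ 0#
      × (∀ (S : Subset m) (W : Subset n) →
           (∀ e → e ∈ W ⇔ (∃ λ i → i ∈ S × ι i ≡ e)) →
           sumSub Y (λ Z → fun f (W ∪ Z)) * (sumSub Y (fun f) ⁻¹) ≡ fun g S)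

  fα : Carrier → BinaryFunction 1
  fα α = binfn F Relation.Binary.PropositionalEquality.refl
    where
      F : Subset 1 → Carrier
      F (outside ∷ []) = 1#
      F (inside ∷ [])  = α

  gNeg : BinaryFunction 2
  gNeg = binfn G Relation.Binary.PropositionalEquality.refl
    where
      G : Subset 2 → Carrier
      G (inside ∷ inside ∷ []) = - 1#
      G (inside ∷ outside ∷ []) = 1#
      G (outside ∷ inside ∷ []) = 1#
      G (outside ∷ outside ∷ []) = 1#

module Submission where

-- Write N(X) = Σ_{Y ⊆ E∖X} f(Y), so that Qf(X) = log₂ (N(∅)/N(X)). Contracting X and deleting
-- everything outside X ∪ {e} leaves f_α with α = N(X)/N(X ∪ {e}) − 1. So f has no f_α minor with
-- α ∉ {0, 1} exactly when no N(X) vanishes (otherwise, going down from N(E) = f(∅) = 1, some minor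
-- has α = −1) and every step X ↦ X ∪ {e} keeps or halves N, that is, when Qf exists and grows by
-- 0 or 1 at each step; matroid rank functions do, and such a Qf is integral, bounded by |X| and
-- monotone. A function with these unit increments is submodular except at a square
-- r(X) = r(X ∪ a) = r(X ∪ b) = r(X ∪ ab) − 1, and the squares are exactly the places where
-- contracting X and deleting everything outside X ∪ {a, b} leaves g.

open import Defs
open import Level using (0ℓ)
open import Algebra.Bundles using (CommutativeRing)
open import Algebra.Consequences.Propositional using (comm∧idˡ⇒id; comm∧invˡ⇒inv; comm∧distrˡ⇒distrʳ)
import Algebra.Properties.CommutativeSemigroup as CommutativeSemigroupProperties
import Algebra.Properties.Group as GroupProperties
import Algebra.Properties.Ring as RingProperties
open import Data.Empty using (⊥-elim)
open import Data.Fin using (Fin; zero; suc)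
open import Data.Fin.Subset using (Subset; inside; outside; ⊥; ⊤; ∁; _∪_; _∈_; _∉_; ∣_∣; ⁅_⁆)
open import Data.Fin.Subset.Properties
  using ( ∪-identityˡ; ∪-identityʳ; ∪-assoc; ∪-comm; x∈p∪q⁻; x∈p∪q⁺; x∈⁅x⁆; x∈⁅y⁆⇒x≡y; ∉⊥; ∈⊤; ∣⊥∣≡0
        ; ⊆-antisym; _∈?_; x∈p⇒x∉∁p; x∈∁p⇒x∉p; x∉∁p⇒x∈p; x∉p⇒x∈∁p; drop-there; drop-not-there)
open import Data.Nat as ℕ using (ℕ; zero; suc; z≤n; s≤s)
import Data.Nat.Properties as ℕₚ
open import Data.Product using (Σ; ∃; ∃₂; _×_; _,_; proj₁; proj₂)
open import Data.Sum using (_⊎_; inj₁; inj₂)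
open import Data.Sum.Function.Propositional using (_⊎-⇔_)
open import Data.Vec using ([]; _∷_; here; there)
open import Function using (_∘_; case_of_)
open import Function.Bundles using (_⇔_; mk⇔; Equivalence)
open import Function.Construct.Composition using (_⇔-∘_)
open import Function.Construct.Symmetry using (⇔-sym)
open import Function.Definitions using (Injective)
open import Relation.Nullary using (¬_; yes; no)
open import Relation.Binary.PropositionalEquality

open Equivalence using (to; from)

module RealFieldProperties (ℝ : RealField) where
  open RealField ℝ

  +-*-commutativeRing : CommutativeRing 0ℓ 0ℓ
  +-*-commutativeRing = record
    { Carrier = Carrier ; _≈_ = _≡_ ; _+_ = _+_ ; _*_ = _*_ ; -_ = -_ ; 0# = 0# ; 1# = 1#
    ; isCommutativeRing = record
      { isRing = record
        { +-isAbelianGroup = record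
          { isGroup = record
            { isMonoid = record
              { isSemigroup = record
                { isMagma = record { isEquivalence = isEquivalence ; ∙-cong = cong₂ _+_ }
                ; assoc = +-assoc }
              ; identity = comm∧idˡ⇒id +-comm +-identityˡ }
            ; inverse = comm∧invˡ⇒inv +-comm -‿inverseˡ
            ; ⁻¹-cong = cong -_ }
          ; comm = +-comm }
        ; *-cong = cong₂ _*_
        ; *-assoc = *-assoc
        ; *-identity = comm∧idˡ⇒id *-comm *-identityˡ
        ; distrib = distribˡ , comm∧distrˡ⇒distrʳ *-comm distribˡ }
      ; *-comm = *-comm } }

  open CommutativeRing +-*-commutativeRing using (+-group; +-commutativeSemigroup; ring)
  open CommutativeRing +-*-commutativeRing public using (_-_; +-identityʳ; -‿inverseʳ; *-identityʳ; distribʳ; zeroˡ)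
  open GroupProperties +-group public
    using (//-rightDividesˡ; //-rightDividesʳ; ⁻¹-involutive)
    renaming (∙-cancelˡ to +-cancelˡ; identityʳ-unique to x+y≡x⇒y≡0; inverseʳ-unique to x+y≡0⇒y≡-x)
  open RingProperties ring public using (-1*x≈-x)
  open CommutativeSemigroupProperties +-commutativeSemigroup public using (interchange)

  x*x⁻¹≡1 : ∀ {x} → x ≢ 0# → x * x ⁻¹ ≡ 1#
  x*x⁻¹≡1 {x} x≢0 = trans (*-comm x (x ⁻¹)) (⁻¹-inverseˡ x x≢0)

  *-cancelˡ-nonZero : ∀ {c} x y → c ≢ 0# → c * x ≡ c * y → x ≡ y
  *-cancelˡ-nonZero {c} x y c≢0 eq = begin
    x                ≡⟨ *-identityˡ x ⟨
    1# * x           ≡⟨ cong (_* x) (⁻¹-inverseˡ c c≢0) ⟨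
    c ⁻¹ * c * x     ≡⟨ *-assoc (c ⁻¹) c x ⟩
    c ⁻¹ * (c * x)   ≡⟨ cong (c ⁻¹ *_) eq ⟩
    c ⁻¹ * (c * y)   ≡⟨ *-assoc (c ⁻¹) c y ⟨
    c ⁻¹ * c * y     ≡⟨ cong (_* y) (⁻¹-inverseˡ c c≢0) ⟩
    1# * y           ≡⟨ *-identityˡ y ⟩
    y                ∎
    where open ≡-Reasoning

  *-cancelʳ-nonZero : ∀ {c} x y → c ≢ 0# → x * c ≡ y * c → x ≡ y
  *-cancelʳ-nonZero {c} x y c≢0 eq =
    *-cancelˡ-nonZero x y c≢0 (trans (*-comm c x) (trans eq (*-comm y c)))

  *⁻¹≡⇔≡* : ∀ {d} x a → d ≢ 0# → (x * d ⁻¹ ≡ a) ⇔ (x ≡ a * d)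
  *⁻¹≡⇔≡* {d} x a d≢0 =
    mk⇔ (λ eq → trans (sym (cancel d (d ⁻¹) x (⁻¹-inverseˡ d d≢0))) (cong (_* d) eq))
        (λ eq → trans (cong (_* d ⁻¹) eq) (cancel (d ⁻¹) d a (x*x⁻¹≡1 d≢0)))
    where
      cancel : ∀ u v w → v * u ≡ 1# → w * v * u ≡ w
      cancel u v w vu≡1 = trans (*-assoc w v u) (trans (cong (w *_) vu≡1) (*-identityʳ w))

  +-cancelʳ-≤ : ∀ x y z → x + z ≤ y + z → x ≤ y
  +-cancelʳ-≤ x y z le = subst₂ _≤_ (//-rightDividesʳ z x) (//-rightDividesʳ z y) (+-mono-≤ _ _ (- z) le)

  +-mono₂-≤ : ∀ {a b c d} → a ≤ b → c ≤ d → a + c ≤ b + d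
  +-mono₂-≤ {a} {b} {c} {d} a≤b c≤d =
    ≤-trans _ _ _ (+-mono-≤ a b c a≤b) (subst₂ _≤_ (+-comm c b) (+-comm d b) (+-mono-≤ c d b c≤d))

  x≤x+y : ∀ x {y} → 0# ≤ y → x ≤ x + y
  x≤x+y x {y} 0≤y = subst₂ _≤_ (+-identityˡ x) (+-comm y x) (+-mono-≤ 0# y x 0≤y)

  0≤1 : 0# ≤ 1#
  0≤1 with ≤-total 0# 1#
  ... | inj₁ 0≤1 = 0≤1
  ... | inj₂ 1≤0 = subst (0# ≤_) -1*-1≡1 (*-nonneg (- 1#) (- 1#) 0≤-1 0≤-1)
    where
      0≤-1 : 0# ≤ - 1#
      0≤-1 = subst₂ _≤_ (-‿inverseʳ 1#) (+-identityˡ (- 1#)) (+-mono-≤ 1# 0# (- 1#) 1≤0)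
      -1*-1≡1 : - 1# * - 1# ≡ 1#
      -1*-1≡1 = trans (-1*x≈-x (- 1#)) (⁻¹-involutive 1#)

  1≰0 : ¬ 1# ≤ 0#
  1≰0 1≤0 = 0≢1 (≤-antisym 0# 1# 0≤1 1≤0)

  1+1≰1 : ¬ 1# + 1# ≤ 1#
  1+1≰1 le = 1≰0 (+-cancelʳ-≤ 1# 0# 1# (subst (1# + 1# ≤_) (sym (+-identityˡ 1#)) le))

  1+1≢0 : 1# + 1# ≢ 0#
  1+1≢0 eq = 1≰0 (subst (1# ≤_) eq (x≤x+y 1# 0≤1))

  -1≢0 : - 1# ≢ 0#
  -1≢0 eq = 0≢1 (trans (sym (-‿inverseʳ 1#)) (trans (cong (1# +_) eq) (+-identityʳ 1#)))

  -1≢1 : - 1# ≢ 1#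
  -1≢1 eq = 1+1≢0 (trans (cong (1# +_) (sym eq)) (-‿inverseʳ 1#))

  2^suc≡ : ∀ k → (2^ ℝ) (suc k) ≡ (2^ ℝ) k + (2^ ℝ) k
  2^suc≡ k = trans (distribʳ ((2^ ℝ) k) 1# 1#) (cong₂ _+_ (*-identityˡ _) (*-identityˡ _))

  2^suc-* : ∀ k x → (2^ ℝ) (suc k) * x ≡ (2^ ℝ) k * (x + x)
  2^suc-* k x = begin
    (2^ ℝ) (suc k) * x             ≡⟨ cong (_* x) (2^suc≡ k) ⟩
    ((2^ ℝ) k + (2^ ℝ) k) * x      ≡⟨ distribʳ x ((2^ ℝ) k) ((2^ ℝ) k) ⟩
    (2^ ℝ) k * x + (2^ ℝ) k * x    ≡⟨ distribˡ ((2^ ℝ) k) x x ⟨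
    (2^ ℝ) k * (x + x)             ∎
    where open ≡-Reasoning

  1≤2^ : ∀ k → 1# ≤ (2^ ℝ) k
  1≤2^ zero    = ≤-refl 1#
  1≤2^ (suc k) = subst (1# ≤_) (sym (2^suc≡ k))
    (≤-trans _ _ _ (1≤2^ k) (x≤x+y _ (≤-trans _ _ _ 0≤1 (1≤2^ k))))

  2^≢0 : ∀ k → (2^ ℝ) k ≢ 0#
  2^≢0 k eq = 1≰0 (subst (1# ≤_) eq (1≤2^ k))

  2^-injective : ∀ i j → (2^ ℝ) i ≡ (2^ ℝ) j → i ≡ j
  2^-injective zero    zero    _  = refl
  2^-injective zero    (suc j) eq = ⊥-elim (1+1≰1 (subst (1# + 1# ≤_) (sym eq) 1+1≤2^suc))
    where
      1+1≤2^suc : 1# + 1# ≤ (2^ ℝ) (suc j)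
      1+1≤2^suc = subst (1# + 1# ≤_) (sym (2^suc≡ j)) (+-mono₂-≤ (1≤2^ j) (1≤2^ j))
  2^-injective (suc i) zero    eq = sym (2^-injective zero (suc i) (sym eq))
  2^-injective (suc i) (suc j) eq = cong suc (2^-injective i j (*-cancelˡ-nonZero _ _ 1+1≢0 eq))

  -- Archimedean argument: s = sup {k·d | k·d ≤ 1} satisfies s ≤ s − d, unless some (k+1)·d
  -- exceeds 1, which forces d ≢ 0.
  ¬¬≡0⇒≤0 : ∀ d → ¬ ¬ (d ≡ 0#) → d ≤ 0#
  ¬¬≡0⇒≤0 d ¬¬d≡0 = +-cancelʳ-≤ d 0# s (subst₂ _≤_ (+-comm s d) (sym (+-identityˡ s)) s+d≤s)
    where
      _·d : ℕ → Carrier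
      zero  ·d = 0#
      suc k ·d = k ·d + d

      ·d≡0 : d ≡ 0# → ∀ k → k ·d ≡ 0#
      ·d≡0 d≡0 zero    = refl
      ·d≡0 d≡0 (suc k) = trans (cong₂ _+_ (·d≡0 d≡0 k) d≡0) (+-identityˡ 0#)

      Multiple≤1 : Carrier → Set
      Multiple≤1 z = ∃ λ k → z ≡ k ·d × k ·d ≤ 1#

      bounded : ∀ z → Multiple≤1 z → z ≤ 1#
      bounded z (k , refl , k·d≤1) = k·d≤1

      supremum : ∃ λ s → (∀ z → Multiple≤1 z → z ≤ s) × (∀ b → (∀ z → Multiple≤1 z → z ≤ b) → s ≤ b)
      supremum = sup Multiple≤1 (0# , zero , refl , 0≤1) (1# , bounded)

      s : Carrier
      s = proj₁ supremum

      s-d-bounds : ∀ z → Multiple≤1 z → z ≤ s - d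
      s-d-bounds z (k , refl , _) with ≤-total (suc k ·d) 1#
      ... | inj₁ sk·d≤1 = +-cancelʳ-≤ (k ·d) (s - d) d
            (subst (suc k ·d ≤_) (sym (//-rightDividesˡ d s)) (proj₁ (proj₂ supremum) _ (suc k , refl , sk·d≤1)))
      ... | inj₂ 1≤sk·d = ⊥-elim (¬¬d≡0 λ d≡0 → 1≰0 (subst (1# ≤_) (·d≡0 d≡0 (suc k)) 1≤sk·d))

      s+d≤s : s + d ≤ s
      s+d≤s = subst (s + d ≤_) (//-rightDividesˡ d s)
        (+-mono-≤ s (s - d) d (proj₂ (proj₂ supremum) (s - d) s-d-bounds))

  ≡-stable : ∀ {x y} → ¬ ¬ (x ≡ y) → x ≡ y
  ≡-stable {x} {y} ¬¬x≡y = ≤-antisym x y (≤-from x y ¬¬x≡y) (≤-from y x (λ y≢x → ¬¬x≡y (y≢x ∘ sym)))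
    where
      ≤-from : ∀ u v → ¬ ¬ (u ≡ v) → u ≤ v
      ≤-from u v ¬¬u≡v = subst₂ _≤_ (//-rightDividesˡ v u) (+-identityˡ v)
        (+-mono-≤ (u - v) 0# v (¬¬≡0⇒≤0 (u - v) λ u-v≢0 →
          ¬¬u≡v λ u≡v → u-v≢0 (trans (cong (_- v) u≡v) (-‿inverseʳ v))))

  ≡0⊎≡1 : ∀ α → ¬ (α ≢ 0# × α ≢ 1#) → α ≡ 0# ⊎ α ≡ 1#
  ≡0⊎≡1 α ¬α∉01 with ≤-total (α + α) 1#
  ... | inj₁ α+α≤1 = inj₁ (≡-stable λ α≢0 → ¬α∉01 (α≢0 , α≢1))
    where
      α≢1 : α ≢ 1#
      α≢1 α≡1 = 1+1≰1 (subst (λ z → z + z ≤ 1#) α≡1 α+α≤1)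
  ... | inj₂ 1≤α+α = inj₂ (≡-stable λ α≢1 → ¬α∉01 (α≢0 , α≢1))
    where
      α≢0 : α ≢ 0#
      α≢0 α≡0 = 1≰0 (subst (1# ≤_) (trans (cong₂ _+_ α≡0 α≡0) (+-identityˡ 0#)) 1≤α+α)

∁⊤≡⊥ : ∀ {n} → ∁ (⊤ {n}) ≡ ⊥
∁⊤≡⊥ {zero}  = refl
∁⊤≡⊥ {suc n} = cong (outside ∷_) ∁⊤≡⊥

∣p∪⁅x⁆∣≡1+∣p∣ : ∀ {n} (p : Subset n) {x} → x ∉ p → ∣ p ∪ ⁅ x ⁆ ∣ ≡ suc ∣ p ∣
∣p∪⁅x⁆∣≡1+∣p∣ (inside  ∷ p) {zero}  x∉p = ⊥-elim (x∉p here)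
∣p∪⁅x⁆∣≡1+∣p∣ (outside ∷ p) {zero}  x∉p = cong (suc ∘ ∣_∣) (∪-identityʳ p)
∣p∪⁅x⁆∣≡1+∣p∣ (outside ∷ p) {suc x} x∉p = ∣p∪⁅x⁆∣≡1+∣p∣ p (drop-not-there x∉p)
∣p∪⁅x⁆∣≡1+∣p∣ (inside  ∷ p) {suc x} x∉p = cong suc (∣p∪⁅x⁆∣≡1+∣p∣ p (drop-not-there x∉p))

x∉p∪⁅y⁆ : ∀ {n} {p : Subset n} {x y} → x ∉ p → x ≢ y → x ∉ p ∪ ⁅ y ⁆
x∉p∪⁅y⁆ {p = p} {y = y} x∉p x≢y x∈ with x∈p∪q⁻ p ⁅ y ⁆ x∈
... | inj₁ x∈p   = x∉p x∈p
... | inj₂ x∈⁅y⁆ = x≢y (x∈⁅y⁆⇒x≡y y x∈⁅y⁆)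

[p∪⁅y⁆]∪⁅x⁆≡p∪⁅x⁆∪⁅y⁆ : ∀ {n} (p : Subset n) x y → (p ∪ ⁅ y ⁆) ∪ ⁅ x ⁆ ≡ p ∪ (⁅ x ⁆ ∪ ⁅ y ⁆)
[p∪⁅y⁆]∪⁅x⁆≡p∪⁅x⁆∪⁅y⁆ p x y = trans (∪-assoc p ⁅ y ⁆ ⁅ x ⁆) (cong (p ∪_) (∪-comm ⁅ y ⁆ ⁅ x ⁆))

insertion-induction : ∀ {n} (P : Subset n → Set) → P ⊥ →
                      (∀ X e → e ∉ X → P X → P (X ∪ ⁅ e ⁆)) → ∀ X → P X
insertion-induction {zero}  P P⊥ step [] = P⊥
insertion-induction {suc n} P P⊥ step (s ∷ X) =
  onHead s (insertion-induction (P ∘ (outside ∷_)) P⊥ stepTail X)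
  where
    stepTail : ∀ X e → e ∉ X → P (outside ∷ X) → P (outside ∷ X ∪ ⁅ e ⁆)
    stepTail X e e∉X = step (outside ∷ X) (suc e) (e∉X ∘ drop-there)
    onHead : ∀ s → P (outside ∷ X) → P (s ∷ X)
    onHead outside p = p
    onHead inside  p = subst (P ∘ (inside ∷_)) (∪-identityʳ X) (step (outside ∷ X) zero (λ ()) p)

deletion-induction : ∀ {n} (P : Subset n → Set) → P ⊤ →
                     (∀ X e → e ∉ X → P (X ∪ ⁅ e ⁆) → P X) → ∀ X → P X
deletion-induction {zero}  P P⊤ step [] = P⊤
deletion-induction {suc n} P P⊤ step (s ∷ X) =
  onHead s (deletion-induction (P ∘ (inside ∷_)) P⊤ stepTail X)
  where
    stepTail : ∀ X e → e ∉ X → P (inside ∷ X ∪ ⁅ e ⁆) → P (inside ∷ X)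
    stepTail X e e∉X = step (inside ∷ X) (suc e) (e∉X ∘ drop-there)
    onHead : ∀ s → P (inside ∷ X) → P (s ∷ X)
    onHead inside  p = p
    onHead outside p = step (outside ∷ X) zero (λ ()) (subst (P ∘ (inside ∷_)) (sym (∪-identityʳ X)) p)

image : ∀ {m n} → (Fin m → Fin n) → Subset m → Subset n
image ι []            = ⊥
image ι (outside ∷ S) = image (ι ∘ suc) S
image ι (inside  ∷ S) = ⁅ ι zero ⁆ ∪ image (ι ∘ suc) S

∈-image⇔ : ∀ {m n} (ι : Fin m → Fin n) S {x} → x ∈ image ι S ⇔ ∃ λ i → i ∈ S × ι i ≡ x
∈-image⇔ ι []            = mk⇔ (⊥-elim ∘ ∉⊥) λ { (() , () , _) }
∈-image⇔ ι (outside ∷ S) = mk⇔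
  (λ x∈ → let (i , i∈S , ιi≡x) = to (∈-image⇔ (ι ∘ suc) S) x∈ in suc i , there i∈S , ιi≡x)
  λ { (suc i , there i∈S , ιi≡x) → from (∈-image⇔ (ι ∘ suc) S) (i , i∈S , ιi≡x) }
∈-image⇔ ι (inside  ∷ S) {x} = mk⇔ toImage fromImage
  where
    toImage : x ∈ image ι (inside ∷ S) → ∃ λ i → i ∈ inside ∷ S × ι i ≡ x
    toImage x∈ with x∈p∪q⁻ ⁅ ι zero ⁆ (image (ι ∘ suc) S) x∈
    ... | inj₁ x∈⁅ι0⁆ = zero , here , sym (x∈⁅y⁆⇒x≡y (ι zero) x∈⁅ι0⁆)
    ... | inj₂ x∈rest = let (i , i∈S , ιi≡x) = to (∈-image⇔ (ι ∘ suc) S) x∈rest in suc i , there i∈S , ιi≡x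
    fromImage : (∃ λ i → i ∈ inside ∷ S × ι i ≡ x) → x ∈ image ι (inside ∷ S)
    fromImage (zero  , _         , refl) = x∈p∪q⁺ (inj₁ (x∈⁅x⁆ (ι zero)))
    fromImage (suc i , there i∈S , ιi≡x) = x∈p∪q⁺ (inj₂ (from (∈-image⇔ (ι ∘ suc) S) (i , i∈S , ιi≡x)))

∈-image-⊤⇔ : ∀ {m n} (ι : Fin m → Fin n) {x} → x ∈ image ι ⊤ ⇔ ∃ λ i → ι i ≡ x
∈-image-⊤⇔ ι = mk⇔ (λ x∈ → let (i , _ , ιi≡x) = to (∈-image⇔ ι ⊤) x∈ in i , ιi≡x)
                   (λ (i , ιi≡x) → from (∈-image⇔ ι ⊤) (i , ∈⊤ , ιi≡x))

image-unique : ∀ {m n} (ι : Fin m → Fin n) S {W} →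
               (∀ x → x ∈ W ⇔ ∃ λ i → i ∈ S × ι i ≡ x) → W ≡ image ι S
image-unique ι S W⇔ = ⊆-antisym (λ {x} x∈W → from (∈-image⇔ ι S) (to (W⇔ x) x∈W))
                                (λ {x} x∈ → from (W⇔ x) (to (∈-image⇔ ι S) x∈))

partition⇔ : ∀ {n} (X Y V : Subset n) →
             ((∀ e → e ∈ X → e ∉ Y) × (∀ e → (e ∉ X × e ∉ Y) ⇔ e ∈ V))
             ⇔ (Y ≡ ∁ (X ∪ V) × (∀ e → e ∈ V → e ∉ X))
partition⇔ X Y V = mk⇔ toComplement fromComplement
  where
    toComplement : (∀ e → e ∈ X → e ∉ Y) × (∀ e → (e ∉ X × e ∉ Y) ⇔ e ∈ V) →
                   Y ≡ ∁ (X ∪ V) × (∀ e → e ∈ V → e ∉ X)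
    toComplement (X∩Y≡∅ , rest⇔V) = ⊆-antisym Y⊆ ⊆Y , λ e e∈V → proj₁ (from (rest⇔V e) e∈V)
      where
        Y⊆ : ∀ {e} → e ∈ Y → e ∈ ∁ (X ∪ V)
        Y⊆ {e} e∈Y = x∉p⇒x∈∁p λ e∈X∪V → case x∈p∪q⁻ X V e∈X∪V of λ where
          (inj₁ e∈X) → X∩Y≡∅ e e∈X e∈Y
          (inj₂ e∈V) → proj₂ (from (rest⇔V e) e∈V) e∈Y
        ⊆Y : ∀ {e} → e ∈ ∁ (X ∪ V) → e ∈ Y
        ⊆Y {e} e∈∁ with e ∈? Y
        ... | yes e∈Y = e∈Y
        ... | no  e∉Y = ⊥-elim (x∈∁p⇒x∉p e∈∁ (x∈p∪q⁺ (inj₂ (to (rest⇔V e) (e∉X , e∉Y)))))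
          where
            e∉X : e ∉ X
            e∉X e∈X = x∈∁p⇒x∉p e∈∁ (x∈p∪q⁺ (inj₁ e∈X))
    fromComplement : Y ≡ ∁ (X ∪ V) × (∀ e → e ∈ V → e ∉ X) →
                     (∀ e → e ∈ X → e ∉ Y) × (∀ e → (e ∉ X × e ∉ Y) ⇔ e ∈ V)
    fromComplement (refl , V∩X≡∅) =
        (λ e e∈X → x∈p⇒x∉∁p (x∈p∪q⁺ (inj₁ e∈X)))
      , λ e → mk⇔ (inV e) λ e∈V → V∩X≡∅ e e∈V , x∈p⇒x∉∁p (x∈p∪q⁺ (inj₂ e∈V))
      where
        inV : ∀ e → e ∉ X × e ∉ ∁ (X ∪ V) → e ∈ V
        inV e (e∉X , e∉∁) with x∈p∪q⁻ X V (x∉∁p⇒x∈p e∉∁)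
        ... | inj₁ e∈X = ⊥-elim (e∉X e∈X)
        ... | inj₂ e∈V = e∈V

module SubsetSums (ℝ : RealField) where
  open RealField ℝ
  open RealFieldProperties ℝ using (interchange)

  sumSub-cong : ∀ {n} (A : Subset n) {G H : Subset n → Carrier} → (∀ Z → G Z ≡ H Z) → sumSub ℝ A G ≡ sumSub ℝ A H
  sumSub-cong []            G≗H = G≗H []
  sumSub-cong (outside ∷ A) G≗H = sumSub-cong A (λ Z → G≗H (outside ∷ Z))
  sumSub-cong (inside  ∷ A) G≗H =
    cong₂ _+_ (sumSub-cong A (λ Z → G≗H (outside ∷ Z))) (sumSub-cong A (λ Z → G≗H (inside ∷ Z)))

  sumSub-⊥ : ∀ {n} (G : Subset n → Carrier) → sumSub ℝ ⊥ G ≡ G ⊥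
  sumSub-⊥ {zero}  G = refl
  sumSub-⊥ {suc n} G = sumSub-⊥ (λ Z → G (outside ∷ Z))

  sumSub-split : ∀ {n} (G : Subset n → Carrier) X {e} → e ∉ X →
                 sumSub ℝ (∁ X) G ≡ sumSub ℝ (∁ (X ∪ ⁅ e ⁆)) G + sumSub ℝ (∁ (X ∪ ⁅ e ⁆)) (λ Z → G (⁅ e ⁆ ∪ Z))
  sumSub-split G (inside  ∷ X) {zero}  e∉X = ⊥-elim (e∉X here)
  sumSub-split G (outside ∷ X) {zero}  e∉X rewrite ∪-identityʳ X =
    cong (sumSub ℝ (∁ X) (λ Z → G (outside ∷ Z)) +_)
         (sumSub-cong (∁ X) (λ Z → cong (λ Z′ → G (inside ∷ Z′)) (sym (∪-identityˡ Z))))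
  sumSub-split G (outside ∷ X) {suc e} e∉X = trans
    (cong₂ _+_ (sumSub-split (λ Z → G (outside ∷ Z)) X (drop-not-there e∉X))
               (sumSub-split (λ Z → G (inside ∷ Z)) X (drop-not-there e∉X)))
    (interchange _ _ _ _)
  sumSub-split G (inside  ∷ X) {suc e} e∉X = sumSub-split (λ Z → G (outside ∷ Z)) X (drop-not-there e∉X)

module UnitIncrements where
  open import Data.Nat using (_+_; _≤_)
  open import Data.Nat.Properties
    using ( module ≤-Reasoning; ≤-refl; ≤-trans; ≤-reflexive; ≤-antisym; m≤n⇒m<n∨m≡n; n≤1+n
          ; +-suc; +-comm; +-cancelˡ-≤; +-monoʳ-≤; 1+n≰n)

  UnitStep : ℕ → ℕ → Set
  UnitStep m k = k ≡ m ⊎ k ≡ suc m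

  unitStep⇒≤ : ∀ {m k} → UnitStep m k → m ≤ k
  unitStep⇒≤ (inj₁ refl) = ≤-refl
  unitStep⇒≤ (inj₂ refl) = n≤1+n _

  unitStep⇒≤suc : ∀ {m k} → UnitStep m k → k ≤ suc m
  unitStep⇒≤suc (inj₁ refl) = n≤1+n _
  unitStep⇒≤suc (inj₂ refl) = ≤-refl

  ≤∧≤suc⇒unitStep : ∀ {m k} → m ≤ k → k ≤ suc m → UnitStep m k
  ≤∧≤suc⇒unitStep m≤k k≤1+m with m≤n⇒m<n∨m≡n m≤k
  ... | inj₁ m<k = inj₂ (≤-antisym k≤1+m m<k)
  ... | inj₂ m≡k = inj₁ (sym m≡k)

  unitSteps⇒submodular : ∀ {r ra rb rab} → UnitStep r ra → UnitStep r rb → UnitStep ra rab → UnitStep rb rab →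
                         ¬ (ra ≡ r × rb ≡ r × rab ≡ suc r) → r + rab ≤ ra + rb
  unitSteps⇒submodular {r} (inj₂ refl) _           _           b→ab _ =
    ≤-trans (+-monoʳ-≤ r (unitStep⇒≤suc b→ab)) (≤-reflexive (+-suc r _))
  unitSteps⇒submodular {r} (inj₁ refl) (inj₂ refl) a→ab        _    _ = +-monoʳ-≤ r (unitStep⇒≤suc a→ab)
  unitSteps⇒submodular     (inj₁ refl) (inj₁ refl) (inj₁ refl) _    _ = ≤-refl
  unitSteps⇒submodular     (inj₁ refl) (inj₁ refl) (inj₂ refl) _    ¬square = ⊥-elim (¬square (refl , refl , refl))

  square⇒¬submodular : ∀ {r ra rb rab} → ra ≡ r × rb ≡ r × rab ≡ suc r → ¬ (r + rab ≤ ra + rb)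
  square⇒¬submodular {r} (refl , refl , refl) r+1+r≤r+r =
    1+n≰n (+-cancelˡ-≤ r (suc r) r r+1+r≤r+r)

  isMatroidRank⇒unitStep : (ℝ : RealField) {n : ℕ} {r : Subset n → ℕ} → IsMatroidRank ℝ r →
                           ∀ X e → e ∉ X → UnitStep (r X) (r (X ∪ ⁅ e ⁆))
  isMatroidRank⇒unitStep ℝ {n} {r} (bounded , monotone , submodular) Y y y∉Y =
    ≤∧≤suc⇒unitStep (monotone Y y y∉Y) (insertion-induction GrowsByAtMostOne base step Y y y∉Y)
    where
      GrowsByAtMostOne : Subset n → Set
      GrowsByAtMostOne X = ∀ e → e ∉ X → r (X ∪ ⁅ e ⁆) ≤ suc (r X)

      base : GrowsByAtMostOne ⊥
      base e _ = ≤-trans (bounded (⊥ ∪ ⁅ e ⁆))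
        (≤-trans (≤-reflexive (trans (∣p∪⁅x⁆∣≡1+∣p∣ (⊥ {n}) {e} ∉⊥) (cong suc (∣⊥∣≡0 n)))) (s≤s z≤n))

      step : ∀ X a → a ∉ X → GrowsByAtMostOne X → GrowsByAtMostOne (X ∪ ⁅ a ⁆)
      step X a a∉X grows e e∉Xa = +-cancelˡ-≤ (r X) _ _ (begin
        r X + r ((X ∪ ⁅ a ⁆) ∪ ⁅ e ⁆)  ≡⟨ cong (λ Y → r X + r Y) (∪-assoc X ⁅ a ⁆ ⁅ e ⁆) ⟩
        r X + r (X ∪ (⁅ a ⁆ ∪ ⁅ e ⁆))  ≤⟨ submodular X a e a≢e a∉X e∉X ⟩
        r (X ∪ ⁅ a ⁆) + r (X ∪ ⁅ e ⁆)  ≤⟨ +-monoʳ-≤ (r (X ∪ ⁅ a ⁆)) (grows e e∉X) ⟩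
        r (X ∪ ⁅ a ⁆) + suc (r X)      ≡⟨ +-comm (r (X ∪ ⁅ a ⁆)) (suc (r X)) ⟩
        suc (r X + r (X ∪ ⁅ a ⁆))      ≡⟨ +-suc (r X) (r (X ∪ ⁅ a ⁆)) ⟨
        r X + suc (r (X ∪ ⁅ a ⁆))      ∎)
        where
          open ≤-Reasoning
          e∉X : e ∉ X
          e∉X e∈X = e∉Xa (x∈p∪q⁺ (inj₁ e∈X))
          a≢e : a ≢ e
          a≢e refl = e∉Xa (x∈p∪q⁺ (inj₂ (x∈⁅x⁆ a)))

open UnitIncrements

module Minors (ℝ : RealField) {n : ℕ} (f : BinaryFunction ℝ n) where
  open RealField ℝ
  open RealFieldProperties ℝ
  open SubsetSums ℝ

  N : Subset n → Carrier
  N = denom ℝ (fun f)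

  sumWith : Subset n → Subset n → Carrier
  sumWith W U = sumSub ℝ (∁ U) (λ Z → fun f (W ∪ Z))

  -- The value at W ⊆ U ∖ X of the minor (f/X)∖(E∖U); it does not depend on X.
  minorValue : Subset n → Subset n → Carrier
  minorValue W U = sumWith W U * N U ⁻¹

  minorValue-⊥ : ∀ U → N U ≢ 0# → minorValue ⊥ U ≡ 1#
  minorValue-⊥ U NU≢0 = trans (cong (_* N U ⁻¹) (sumSub-cong (∁ U) (cong (fun f) ∘ ∪-identityˡ))) (x*x⁻¹≡1 NU≢0)

  minorValue≡⇔ : ∀ {W} U c {s} → N U ≢ 0# → c * N U ≡ s → minorValue W U ≡ c ⇔ sumWith W U ≡ s
  minorValue≡⇔ {W} U c NU≢0 c*NU≡s = mk⇔
    (λ eq → trans (to (*⁻¹≡⇔≡* (sumWith W U) c NU≢0) eq) c*NU≡s)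
    (λ eq → from (*⁻¹≡⇔≡* (sumWith W U) c NU≢0) (trans eq (sym c*NU≡s)))

  IsMinorAt : ∀ {m} → BinaryFunction ℝ m → Subset n → (Fin m → Fin n) → Set
  IsMinorAt g X ι = Injective _≡_ _≡_ ι × (∀ i → ι i ∉ X) × N (X ∪ image ι ⊤) ≢ 0#
                  × (∀ S → minorValue (image ι S) (X ∪ image ι ⊤) ≡ fun g S)

  hasMinorIso⇔ : ∀ {m} (g : BinaryFunction ℝ m) → HasMinorIso ℝ f g ⇔ ∃₂ (IsMinorAt g)
  hasMinorIso⇔ g = mk⇔ toNormalForm fromNormalForm
    where
      toNormalForm : HasMinorIso ℝ f g → ∃₂ (IsMinorAt g)
      toNormalForm (X , Y , ι , X∩Y≡∅ , ι-injective , rest⇔image , NY≢0 , values)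
        with to (partition⇔ X Y (image ι ⊤)) (X∩Y≡∅ , λ e → ⇔-sym (∈-image-⊤⇔ ι) ⇔-∘ rest⇔image e)
      ... | refl , image∩X≡∅ =
        X , ι , ι-injective , (λ i → image∩X≡∅ (ι i) (from (∈-image-⊤⇔ ι) (i , refl))) , NY≢0 ,
        λ S → values S (image ι S) (λ _ → ∈-image⇔ ι S)

      fromNormalForm : ∃₂ (IsMinorAt g) → HasMinorIso ℝ f g
      fromNormalForm (X , ι , ι-injective , ι∉X , NU≢0 , values)
        with from (partition⇔ X (∁ (X ∪ image ι ⊤)) (image ι ⊤))
                  (refl , λ e e∈image → case to (∈-image-⊤⇔ ι) e∈image of λ where (i , refl) → ι∉X i)
      ... | X∩Y≡∅ , rest⇔image =
        X , ∁ (X ∪ image ι ⊤) , ι , X∩Y≡∅ , ι-injective , (λ e → ∈-image-⊤⇔ ι ⇔-∘ rest⇔image e) , NU≢0 ,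
        λ S W W⇔ → subst (λ W → minorValue W (X ∪ image ι ⊤) ≡ fun g S) (sym (image-unique ι S W⇔)) (values S)

  ratio : Subset n → Fin n → Carrier
  ratio X e = minorValue ⁅ e ⁆ (X ∪ ⁅ e ⁆)

  fα-minor⇔ : ∀ α → HasMinorIso ℝ f (fα ℝ α) ⇔ ∃₂ λ X e → e ∉ X × N (X ∪ ⁅ e ⁆) ≢ 0# × ratio X e ≡ α
  fα-minor⇔ α = mk⇔ toRatio fromRatio ⇔-∘ hasMinorIso⇔ (fα ℝ α)
    where
      -- V is ⁅ e ⁆, up to the trailing ∪ ⊥ that image leaves.
      RatioAt : Subset n → Subset n → Set
      RatioAt X V = N (X ∪ V) ≢ 0# × minorValue V (X ∪ V) ≡ α

      toRatio : ∃₂ (IsMinorAt (fα ℝ α)) → ∃₂ λ X e → e ∉ X × RatioAt X ⁅ e ⁆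
      toRatio (X , ι , _ , ι∉X , NU≢0 , values) =
        X , ι zero , ι∉X zero , subst (RatioAt X) (∪-identityʳ ⁅ ι zero ⁆) (NU≢0 , values (inside ∷ []))

      fromRatio : (∃₂ λ X e → e ∉ X × RatioAt X ⁅ e ⁆) → ∃₂ (IsMinorAt (fα ℝ α))
      fromRatio (X , e , e∉X , ratioAt) =
        X , (λ _ → e) , (λ { {zero} {zero} _ → refl }) , (λ _ → e∉X) , proj₁ ratioAt∪⊥ , values
        where
          ratioAt∪⊥ : RatioAt X (⁅ e ⁆ ∪ ⊥)
          ratioAt∪⊥ = subst (RatioAt X) (sym (∪-identityʳ ⁅ e ⁆)) ratioAt
          values : ∀ S → minorValue (image (λ _ → e) S) (X ∪ (⁅ e ⁆ ∪ ⊥)) ≡ fun (fα ℝ α) S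
          values (outside ∷ []) = minorValue-⊥ (X ∪ (⁅ e ⁆ ∪ ⊥)) (proj₁ ratioAt∪⊥)
          values (inside  ∷ []) = proj₂ ratioAt∪⊥

  NegativeSquare : Subset n → Fin n → Fin n → Set
  NegativeSquare X a b = N Xab ≢ 0# × sumWith ⁅ a ⁆ Xab ≡ N Xab × sumWith ⁅ b ⁆ Xab ≡ N Xab
                       × sumWith (⁅ a ⁆ ∪ ⁅ b ⁆) Xab ≡ - N Xab
    where
      Xab : Subset n
      Xab = X ∪ (⁅ a ⁆ ∪ ⁅ b ⁆)

  gNeg-minor⇔ : HasMinorIso ℝ f (gNeg ℝ) ⇔ ∃ λ X → ∃₂ λ a b → a ≢ b × a ∉ X × b ∉ X × NegativeSquare X a b
  gNeg-minor⇔ = mk⇔ toSquare fromSquare ⇔-∘ hasMinorIso⇔ (gNeg ℝ)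
    where
      -- A and B are ⁅ a ⁆ and ⁅ b ⁆, up to the trailing ∪ ⊥ that image leaves.
      ValuesAt : Subset n → Fin n → Subset n → Subset n → Set
      ValuesAt X a A B = N U ≢ 0# × minorValue A U ≡ 1# × minorValue B U ≡ 1# × minorValue (⁅ a ⁆ ∪ B) U ≡ - 1#
        where
          U : Subset n
          U = X ∪ (⁅ a ⁆ ∪ B)

      valuesAt⇔square : ∀ X a b → ValuesAt X a ⁅ a ⁆ ⁅ b ⁆ ⇔ NegativeSquare X a b
      valuesAt⇔square X a b = mk⇔
        (λ (NU≢0 , va , vb , vab) → NU≢0 , to (≡1 NU≢0) va , to (≡1 NU≢0) vb , to (≡-1 NU≢0) vab)
        (λ (NU≢0 , sa , sb , sab) → NU≢0 , from (≡1 NU≢0) sa , from (≡1 NU≢0) sb , from (≡-1 NU≢0) sab)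
        where
          U : Subset n
          U = X ∪ (⁅ a ⁆ ∪ ⁅ b ⁆)
          ≡1 : ∀ {W} → N U ≢ 0# → minorValue W U ≡ 1# ⇔ sumWith W U ≡ N U
          ≡1 NU≢0 = minorValue≡⇔ U 1# NU≢0 (*-identityˡ (N U))
          ≡-1 : ∀ {W} → N U ≢ 0# → minorValue W U ≡ - 1# ⇔ sumWith W U ≡ - N U
          ≡-1 NU≢0 = minorValue≡⇔ U (- 1#) NU≢0 (-1*x≈-x (N U))

      toSquare : ∃₂ (IsMinorAt (gNeg ℝ)) → ∃ λ X → ∃₂ λ a b → a ≢ b × a ∉ X × b ∉ X × NegativeSquare X a b
      toSquare (X , ι , ι-injective , ι∉X , NU≢0 , values) =
        X , ι zero , ι (suc zero) , (λ a≡b → case ι-injective a≡b of λ ()) , ι∉X zero , ι∉X (suc zero) ,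
        to (valuesAt⇔square X (ι zero) (ι (suc zero)))
          (subst₂ (ValuesAt X (ι zero)) (∪-identityʳ ⁅ ι zero ⁆) (∪-identityʳ ⁅ ι (suc zero) ⁆)
            (NU≢0 , values (inside ∷ outside ∷ []) , values (outside ∷ inside ∷ []) ,
                    values (inside ∷ inside ∷ [])))

      fromSquare : (∃ λ X → ∃₂ λ a b → a ≢ b × a ∉ X × b ∉ X × NegativeSquare X a b) → ∃₂ (IsMinorAt (gNeg ℝ))
      fromSquare (X , a , b , a≢b , a∉X , b∉X , square) =
        X , ι , ι-injective , ι∉X , proj₁ valuesAt∪⊥ , values
        where
          ι : Fin 2 → Fin n
          ι zero       = a
          ι (suc zero) = b
          ι-injective : Injective _≡_ _≡_ ι
          ι-injective {zero}     {zero}     _   = refl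
          ι-injective {zero}     {suc zero} a≡b = ⊥-elim (a≢b a≡b)
          ι-injective {suc zero} {zero}     b≡a = ⊥-elim (a≢b (sym b≡a))
          ι-injective {suc zero} {suc zero} _   = refl
          ι∉X : ∀ i → ι i ∉ X
          ι∉X zero       = a∉X
          ι∉X (suc zero) = b∉X
          valuesAt∪⊥ : ValuesAt X a (⁅ a ⁆ ∪ ⊥) (⁅ b ⁆ ∪ ⊥)
          valuesAt∪⊥ = subst₂ (ValuesAt X a) (sym (∪-identityʳ ⁅ a ⁆)) (sym (∪-identityʳ ⁅ b ⁆))
                              (from (valuesAt⇔square X a b) square)
          values : ∀ S → minorValue (image ι S) (X ∪ image ι ⊤) ≡ fun (gNeg ℝ) S
          values (outside ∷ outside ∷ []) = minorValue-⊥ (X ∪ image ι ⊤) (proj₁ valuesAt∪⊥)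
          values (inside  ∷ outside ∷ []) = proj₁ (proj₂ valuesAt∪⊥)
          values (outside ∷ inside  ∷ []) = proj₁ (proj₂ (proj₂ valuesAt∪⊥))
          values (inside  ∷ inside  ∷ []) = proj₂ (proj₂ (proj₂ valuesAt∪⊥))

  N-split : ∀ X {e} → e ∉ X → N X ≡ N (X ∪ ⁅ e ⁆) + sumWith ⁅ e ⁆ (X ∪ ⁅ e ⁆)
  N-split X = sumSub-split (fun f) X

  sumWith-split : ∀ W U {e} → e ∉ U →
                  sumWith W U ≡ sumWith W (U ∪ ⁅ e ⁆) + sumWith (W ∪ ⁅ e ⁆) (U ∪ ⁅ e ⁆)
  sumWith-split W U {e} e∉U = trans (sumSub-split (λ Z → fun f (W ∪ Z)) U e∉U)
    (cong (sumWith W (U ∪ ⁅ e ⁆) +_) (sumSub-cong (∁ (U ∪ ⁅ e ⁆)) λ Z → cong (fun f) (sym (∪-assoc W ⁅ e ⁆ Z))))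

  ratio≡⇔ : ∀ X {e} c {s} → e ∉ X → N (X ∪ ⁅ e ⁆) ≢ 0# → N (X ∪ ⁅ e ⁆) + c * N (X ∪ ⁅ e ⁆) ≡ s →
            ratio X e ≡ c ⇔ N X ≡ s
  ratio≡⇔ X {e} c e∉X D≢0 D+cD≡s = mk⇔
    (λ ratio≡c → trans (N-split X e∉X) (trans (cong (D +_) (to value⇔ ratio≡c)) D+cD≡s))
    (λ NX≡s → from value⇔ (+-cancelˡ D _ _ (trans (sym (N-split X e∉X)) (trans NX≡s (sym D+cD≡s)))))
    where
      D : Carrier
      D = N (X ∪ ⁅ e ⁆)
      value⇔ : ratio X e ≡ c ⇔ sumWith ⁅ e ⁆ (X ∪ ⁅ e ⁆) ≡ c * D
      value⇔ = minorValue≡⇔ (X ∪ ⁅ e ⁆) c D≢0 refl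

  ratio≡0⇔ : ∀ X {e} → e ∉ X → N (X ∪ ⁅ e ⁆) ≢ 0# → ratio X e ≡ 0# ⇔ N X ≡ N (X ∪ ⁅ e ⁆)
  ratio≡0⇔ X {e} e∉X D≢0 =
    ratio≡⇔ X 0# e∉X D≢0 (trans (cong (N (X ∪ ⁅ e ⁆) +_) (zeroˡ _)) (+-identityʳ _))

  ratio≡1⇔ : ∀ X {e} → e ∉ X → N (X ∪ ⁅ e ⁆) ≢ 0# → ratio X e ≡ 1# ⇔ N X ≡ N (X ∪ ⁅ e ⁆) + N (X ∪ ⁅ e ⁆)
  ratio≡1⇔ X {e} e∉X D≢0 = ratio≡⇔ X 1# e∉X D≢0 (cong (N (X ∪ ⁅ e ⁆) +_) (*-identityˡ _))

  N≡0⇒ratio≡-1 : ∀ X {e} → e ∉ X → N (X ∪ ⁅ e ⁆) ≢ 0# → N X ≡ 0# → ratio X e ≡ - 1#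
  N≡0⇒ratio≡-1 X {e} e∉X D≢0 =
    from (ratio≡⇔ X (- 1#) e∉X D≢0 (trans (cong (N (X ∪ ⁅ e ⁆) +_) (-1*x≈-x _)) (-‿inverseʳ _)))

  square-decomposition : ∀ X {a b} → a ≢ b → a ∉ X → b ∉ X →
      N (X ∪ ⁅ a ⁆) ≡ N (X ∪ (⁅ a ⁆ ∪ ⁅ b ⁆)) + sumWith ⁅ b ⁆ (X ∪ (⁅ a ⁆ ∪ ⁅ b ⁆))
    × N (X ∪ ⁅ b ⁆) ≡ N (X ∪ (⁅ a ⁆ ∪ ⁅ b ⁆)) + sumWith ⁅ a ⁆ (X ∪ (⁅ a ⁆ ∪ ⁅ b ⁆))
    × N X ≡ N (X ∪ ⁅ a ⁆) + (sumWith ⁅ a ⁆ (X ∪ (⁅ a ⁆ ∪ ⁅ b ⁆)) + sumWith (⁅ a ⁆ ∪ ⁅ b ⁆) (X ∪ (⁅ a ⁆ ∪ ⁅ b ⁆)))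
  square-decomposition X {a} {b} a≢b a∉X b∉X =
      subst (λ U → N (X ∪ ⁅ a ⁆) ≡ N U + sumWith ⁅ b ⁆ U) (∪-assoc X ⁅ a ⁆ ⁅ b ⁆) (N-split (X ∪ ⁅ a ⁆) b∉Xa)
    , subst (λ U → N (X ∪ ⁅ b ⁆) ≡ N U + sumWith ⁅ a ⁆ U) ([p∪⁅y⁆]∪⁅x⁆≡p∪⁅x⁆∪⁅y⁆ X a b)
            (N-split (X ∪ ⁅ b ⁆) (x∉p∪⁅y⁆ a∉X a≢b))
    , trans (N-split X a∉X) (cong (N (X ∪ ⁅ a ⁆) +_)
        (subst (λ U → sumWith ⁅ a ⁆ (X ∪ ⁅ a ⁆) ≡ sumWith ⁅ a ⁆ U + sumWith (⁅ a ⁆ ∪ ⁅ b ⁆) U)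
               (∪-assoc X ⁅ a ⁆ ⁅ b ⁆) (sumWith-split ⁅ a ⁆ (X ∪ ⁅ a ⁆) b∉Xa)))
    where
      b∉Xa : b ∉ X ∪ ⁅ a ⁆
      b∉Xa = x∉p∪⁅y⁆ b∉X (a≢b ∘ sym)

  module Rank (r : Subset n → ℕ) (N≢0 : ∀ X → N X ≢ 0#) (N⊥≡ : ∀ X → N ⊥ ≡ (2^ ℝ) (r X) * N X) where

    private
      scale : ∀ X Y → (2^ ℝ) (r X) * N X ≡ (2^ ℝ) (r Y) * N Y
      scale X Y = trans (sym (N⊥≡ X)) (N⊥≡ Y)

    r≡⇔ : ∀ X Y → r Y ≡ r X ⇔ N X ≡ N Y
    r≡⇔ X Y = mk⇔
      (λ rY≡rX → *-cancelˡ-nonZero (N X) (N Y) (2^≢0 (r X))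
                   (trans (scale X Y) (cong (λ k → (2^ ℝ) k * N Y) rY≡rX)))
      (λ NX≡NY → 2^-injective (r Y) (r X) (*-cancelʳ-nonZero _ _ (N≢0 Y)
                   (trans (sym (scale X Y)) (cong ((2^ ℝ) (r X) *_) NX≡NY))))

    r≡suc⇔ : ∀ X Y → r Y ≡ suc (r X) ⇔ N X ≡ N Y + N Y
    r≡suc⇔ X Y = mk⇔
      (λ rY≡1+rX → *-cancelˡ-nonZero (N X) (N Y + N Y) (2^≢0 (r X))
        (trans (scale X Y) (trans (cong (λ k → (2^ ℝ) k * N Y) rY≡1+rX) (2^suc-* (r X) (N Y)))))
      (λ NX≡2NY → 2^-injective (r Y) (suc (r X)) (*-cancelʳ-nonZero _ _ (N≢0 Y)
        (trans (sym (scale X Y)) (trans (cong ((2^ ℝ) (r X) *_) NX≡2NY) (sym (2^suc-* (r X) (N Y)))))))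

    unitStep⇔ : ∀ X {e} → e ∉ X → UnitStep (r X) (r (X ∪ ⁅ e ⁆)) ⇔ (ratio X e ≡ 0# ⊎ ratio X e ≡ 1#)
    unitStep⇔ X {e} e∉X =
      (⇔-sym (ratio≡0⇔ X e∉X (N≢0 (X ∪ ⁅ e ⁆))) ⇔-∘ r≡⇔ X (X ∪ ⁅ e ⁆)) ⊎-⇔
      (⇔-sym (ratio≡1⇔ X e∉X (N≢0 (X ∪ ⁅ e ⁆))) ⇔-∘ r≡suc⇔ X (X ∪ ⁅ e ⁆))

    negativeSquare⇔ : ∀ X {a b} → a ≢ b → a ∉ X → b ∉ X →
      NegativeSquare X a b ⇔ (r (X ∪ ⁅ a ⁆) ≡ r X × r (X ∪ ⁅ b ⁆) ≡ r X × r (X ∪ (⁅ a ⁆ ∪ ⁅ b ⁆)) ≡ suc (r X))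
    negativeSquare⇔ X {a} {b} a≢b a∉X b∉X with square-decomposition X a≢b a∉X b∉X
    ... | NXa≡ , NXb≡ , NX≡ = mk⇔ toRanks fromRanks
      where
        Xab : Subset n
        Xab = X ∪ (⁅ a ⁆ ∪ ⁅ b ⁆)
        D : Carrier
        D = N Xab

        toRanks : NegativeSquare X a b → r (X ∪ ⁅ a ⁆) ≡ r X × r (X ∪ ⁅ b ⁆) ≡ r X × r Xab ≡ suc (r X)
        toRanks (_ , ga≡D , gb≡D , gab≡-D) =
          from (r≡⇔ X _) (trans NX≡2D (sym NXa≡2D)) , from (r≡⇔ X _) (trans NX≡2D (sym NXb≡2D)) ,
          from (r≡suc⇔ X Xab) NX≡2D
          where
            NXa≡2D : N (X ∪ ⁅ a ⁆) ≡ D + D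
            NXa≡2D = trans NXa≡ (cong (D +_) gb≡D)
            NXb≡2D : N (X ∪ ⁅ b ⁆) ≡ D + D
            NXb≡2D = trans NXb≡ (cong (D +_) ga≡D)
            NX≡2D : N X ≡ D + D
            NX≡2D = trans NX≡ (trans (cong₂ _+_ NXa≡2D (trans (cong₂ _+_ ga≡D gab≡-D) (-‿inverseʳ D)))
                                     (+-identityʳ _))

        fromRanks : r (X ∪ ⁅ a ⁆) ≡ r X × r (X ∪ ⁅ b ⁆) ≡ r X × r Xab ≡ suc (r X) → NegativeSquare X a b
        fromRanks (rXa≡rX , rXb≡rX , rXab≡1+rX) = N≢0 Xab , ga≡D , gb≡D , gab≡-D
          where
            NX≡2D : N X ≡ D + D
            NX≡2D = to (r≡suc⇔ X Xab) rXab≡1+rX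
            gb≡D : sumWith ⁅ b ⁆ Xab ≡ D
            gb≡D = +-cancelˡ D _ D (trans (sym NXa≡) (trans (sym (to (r≡⇔ X _) rXa≡rX)) NX≡2D))
            ga≡D : sumWith ⁅ a ⁆ Xab ≡ D
            ga≡D = +-cancelˡ D _ D (trans (sym NXb≡) (trans (sym (to (r≡⇔ X _) rXb≡rX)) NX≡2D))
            ga+gab≡0 : sumWith ⁅ a ⁆ Xab + sumWith (⁅ a ⁆ ∪ ⁅ b ⁆) Xab ≡ 0#
            ga+gab≡0 = x+y≡x⇒y≡0 (N (X ∪ ⁅ a ⁆)) _ (trans (sym NX≡) (to (r≡⇔ X _) rXa≡rX))
            gab≡-D : sumWith (⁅ a ⁆ ∪ ⁅ b ⁆) Xab ≡ - D
            gab≡-D = trans (x+y≡0⇒y≡-x _ _ ga+gab≡0) (cong -_ ga≡D)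

module Characterisation (ℝ : RealField) {n : ℕ} (f : BinaryFunction ℝ n) where
  open RealField ℝ
  open RealFieldProperties ℝ
  open SubsetSums ℝ
  open Minors ℝ f

  ForbiddenMinorFree : Set
  ForbiddenMinorFree = (¬ ∃ λ α → α ≢ 0# × α ≢ 1# × HasMinorIso ℝ f (fα ℝ α)) × ¬ HasMinorIso ℝ f (gNeg ℝ)

  matroidal⇒forbiddenMinorFree : Matroidal ℝ f → ForbiddenMinorFree
  matroidal⇒forbiddenMinorFree (r , r-isQf , r-isRank) = noFα , noGNeg
    where
      N≢0 : ∀ X → N X ≢ 0#
      N≢0 X = proj₁ (r-isQf X)
      N⊥≡ : ∀ X → N ⊥ ≡ (2^ ℝ) (r X) * N X
      N⊥≡ X = to (*⁻¹≡⇔≡* (N ⊥) ((2^ ℝ) (r X)) (N≢0 X)) (proj₂ (r-isQf X))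
      open Rank r N≢0 N⊥≡

      noFα : ¬ ∃ λ α → α ≢ 0# × α ≢ 1# × HasMinorIso ℝ f (fα ℝ α)
      noFα (α , α≢0 , α≢1 , minor) with to (fα-minor⇔ α) minor
      ... | X , e , e∉X , _ , ratio≡α with to (unitStep⇔ X e∉X) (isMatroidRank⇒unitStep ℝ r-isRank X e e∉X)
      ... | inj₁ ratio≡0 = α≢0 (trans (sym ratio≡α) ratio≡0)
      ... | inj₂ ratio≡1 = α≢1 (trans (sym ratio≡α) ratio≡1)

      noGNeg : ¬ HasMinorIso ℝ f (gNeg ℝ)
      noGNeg minor with to gNeg-minor⇔ minor
      ... | X , a , b , a≢b , a∉X , b∉X , square =
        square⇒¬submodular (to (negativeSquare⇔ X a≢b a∉X b∉X) square) (proj₂ (proj₂ r-isRank) X a b a≢b a∉X b∉X)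

  forbiddenMinorFree⇒matroidal : ForbiddenMinorFree → Matroidal ℝ f
  forbiddenMinorFree⇒matroidal (noFα , noGNeg) =
    r , (λ X → N≢0 X , from (*⁻¹≡⇔≡* (N ⊥) _ (N≢0 X)) (N⊥≡ X)) ,
    proj₁ ∘ proj₂ ∘ rank , (λ X e e∉X → unitStep⇒≤ (unitStep X e e∉X)) , submodular
    where
      N≢0 : ∀ X → N X ≢ 0#
      N≢0 = deletion-induction (λ X → N X ≢ 0#) N⊤≢0 step
        where
          N⊤≢0 : N ⊤ ≢ 0#
          N⊤≢0 N⊤≡0 = 0≢1 (begin
            0#                  ≡⟨ N⊤≡0 ⟨
            N ⊤                 ≡⟨ cong (λ A → sumSub ℝ A (fun f)) ∁⊤≡⊥ ⟩
            sumSub ℝ ⊥ (fun f)  ≡⟨ sumSub-⊥ (fun f) ⟩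
            fun f ⊥             ≡⟨ fun-∅ f ⟩
            1#                  ∎)
            where open ≡-Reasoning
          step : ∀ X e → e ∉ X → N (X ∪ ⁅ e ⁆) ≢ 0# → N X ≢ 0#
          step X e e∉X D≢0 NX≡0 =
            noFα (- 1# , -1≢0 , -1≢1 , from (fα-minor⇔ (- 1#)) (X , e , e∉X , D≢0 , N≡0⇒ratio≡-1 X e∉X D≢0 NX≡0))

      ratio∈01 : ∀ X {e} → e ∉ X → ratio X e ≡ 0# ⊎ ratio X e ≡ 1#
      ratio∈01 X {e} e∉X = ≡0⊎≡1 (ratio X e) λ (≢0 , ≢1) →
        noFα (ratio X e , ≢0 , ≢1 , from (fα-minor⇔ (ratio X e)) (X , e , e∉X , N≢0 (X ∪ ⁅ e ⁆) , refl))

      RankAt : Subset n → Set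
      RankAt X = Σ ℕ λ k → k ℕ.≤ ∣ X ∣ × N ⊥ ≡ (2^ ℝ) k * N X

      rank : ∀ X → RankAt X
      rank = insertion-induction RankAt (0 , z≤n , sym (*-identityˡ (N ⊥))) step
        where
          step : ∀ X e → e ∉ X → RankAt X → RankAt (X ∪ ⁅ e ⁆)
          step X e e∉X (k , k≤∣X∣ , N⊥≡) rewrite ∣p∪⁅x⁆∣≡1+∣p∣ X e∉X with ratio∈01 X e∉X
          ... | inj₁ ratio≡0 = k , ℕₚ.m≤n⇒m≤1+n k≤∣X∣ ,
            trans N⊥≡ (cong ((2^ ℝ) k *_) (to (ratio≡0⇔ X e∉X (N≢0 (X ∪ ⁅ e ⁆))) ratio≡0))
          ... | inj₂ ratio≡1 = suc k , s≤s k≤∣X∣ ,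
            trans N⊥≡ (trans (cong ((2^ ℝ) k *_) (to (ratio≡1⇔ X e∉X (N≢0 (X ∪ ⁅ e ⁆))) ratio≡1))
                             (sym (2^suc-* k _)))

      r : Subset n → ℕ
      r = proj₁ ∘ rank
      N⊥≡ : ∀ X → N ⊥ ≡ (2^ ℝ) (r X) * N X
      N⊥≡ = proj₂ ∘ proj₂ ∘ rank
      open Rank r N≢0 N⊥≡

      unitStep : ∀ X e → e ∉ X → UnitStep (r X) (r (X ∪ ⁅ e ⁆))
      unitStep X e e∉X = from (unitStep⇔ X e∉X) (ratio∈01 X e∉X)

      submodular : ∀ X a b → a ≢ b → a ∉ X → b ∉ X →
                   r X ℕ.+ r (X ∪ (⁅ a ⁆ ∪ ⁅ b ⁆)) ℕ.≤ r (X ∪ ⁅ a ⁆) ℕ.+ r (X ∪ ⁅ b ⁆)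
      submodular X a b a≢b a∉X b∉X = unitSteps⇒submodular (unitStep X a a∉X) (unitStep X b b∉X)
        (subst (UnitStep (r (X ∪ ⁅ a ⁆)) ∘ r) (∪-assoc X ⁅ a ⁆ ⁅ b ⁆)
               (unitStep (X ∪ ⁅ a ⁆) b (x∉p∪⁅y⁆ b∉X (a≢b ∘ sym))))
        (subst (UnitStep (r (X ∪ ⁅ b ⁆)) ∘ r) ([p∪⁅y⁆]∪⁅x⁆≡p∪⁅x⁆∪⁅y⁆ X a b)
               (unitStep (X ∪ ⁅ b ⁆) a (x∉p∪⁅y⁆ a∉X a≢b)))
        λ square → noGNeg (from gNeg-minor⇔
          (X , a , b , a≢b , a∉X , b∉X , from (negativeSquare⇔ X a≢b a∉X b∉X) square))

corollary12 : (ℝ : RealField) → (n : ℕ) → (f : BinaryFunction ℝ n) →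
    Matroidal ℝ f ⇔
      ((¬ ∃ λ (α : RealField.Carrier ℝ) →
            α ≢ RealField.0# ℝ × α ≢ RealField.1# ℝ × HasMinorIso ℝ f (fα ℝ α))
       × ¬ HasMinorIso ℝ f (gNeg ℝ))
corollary12 ℝ n f = mk⇔ matroidal⇒forbiddenMinorFree forbiddenMinorFree⇒matroidal
  where open Characterisation ℝ f
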